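{- For all non-negative integers $j$ and $a$, \[\binom{j}{a}-(-1)^j\delta_{j,a}=\sum_{\ell=\lfloor a/2\rfloor}^{a}\left\{2\binom{\ell+1}{a-\ell}-\binom{\ell}{a-\ell}\right\}\binom{j-\ell-1}{\ell},\] where $\delta_{j,a}$ is the Kronecker delta.
   Context: Convention: $\binom{n}{m}=0$ unless the integers $n,m$ satisfy $n\ge m\ge0$. -}

module Defs where

open import Data.Nat as ℕ using (ℕ; zero; suc; _∸_)
open import Data.Nat.Combinatorics using (_C_)
open import Data.Integer as ℤ using (ℤ; +_; -[1+_]; _+_; _*_; _-_; -_)
open import Data.Bool using (if_then_else_)

-- Binomial coefficient on integers, with the convention
-- binom n m = 0 unless n ≥ m ≥ 0.  (ℕ's _C_ already gives 0 when m > n.)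
binom : ℤ → ℤ → ℤ
binom (+ n) (+ m) = + (n C m)
binom (+ n) -[1+ m ] = + 0
binom -[1+ n ] m = + 0

δ : ℕ → ℕ → ℤ
δ j a = if j ℕ.≡ᵇ a then + 1 else + 0

sgn : ℕ → ℤ
sgn zero = + 1
sgn (suc j) = - sgn j

sumFrom : ℕ → ℕ → (ℕ → ℤ) → ℤ
sumFrom lo zero f = + 0
sumFrom lo (suc k) f = f lo + sumFrom (suc lo) k f

-- Σ_{ℓ = lo}^{hi} f ℓ  (inclusive; empty when hi < lo)
sumRange : ℕ → ℕ → (ℕ → ℤ) → ℤ
sumRange lo hi f = sumFrom lo (suc hi ∸ lo) f

-- Both sides satisfy the recurrence  X(j+2, a+2) = X(j+1, a+2) + X(j, a+1) + X(j, a):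
-- for the left side this is Pascal's rule applied twice (the δ-terms cancel in pairs),
-- for the right side it follows termwise from the Pascal recurrences
-- c(a+2, ℓ+1) = c(a+1, ℓ) + c(a, ℓ) of the bracketed coefficient and
-- D(j+2, ℓ+1) = D(j+1, ℓ+1) + D(j, ℓ) of the diagonal binomial D(j, ℓ) = C(j-ℓ-1, ℓ).
-- The coefficient vanishes for ℓ > a and for 2ℓ + 2 ≤ a, so the sum may run over 0 ≤ ℓ ≤ a,
-- and the cases j ≤ 1 or a ≤ 1 are checked directly.
module Submission where

open import Defs
open import Data.Nat as ℕ using (ℕ; zero; suc; _/_; _∸_; _≤_; _<_; s≤s)
import Data.Nat.Properties as ℕ
open import Data.Nat.DivMod using (m/n*n≤m; m/n≤m)
open import Data.Nat.Combinatorics using (_C_; nCk+nC[k+1]≡[n+1]C[k+1]; k>n⇒nCk≡0; nC1≡n)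
open import Data.Integer using (ℤ; +_; -[1+_]; _+_; _*_; _-_; -_)
import Data.Integer.Properties as ℤ
open import Data.Integer.Tactic.RingSolver using (solve-∀)
import Data.Nat.Tactic.RingSolver as ℕ-Solver
open import Function using (_∘_)
open import Relation.Binary.PropositionalEquality
  using (_≡_; refl; sym; trans; cong; cong₂; module ≡-Reasoning)

open ≡-Reasoning

sumFrom-shift : ∀ lo k f → sumFrom (suc lo) k f ≡ sumFrom lo k (f ∘ suc)
sumFrom-shift lo zero    f = refl
sumFrom-shift lo (suc k) f = cong (_+_ (f (suc lo))) (sumFrom-shift (suc lo) k f)

sumFrom-cong : ∀ lo k {f g} → (∀ i → f i ≡ g i) → sumFrom lo k f ≡ sumFrom lo k g
sumFrom-cong lo zero    f≗g = refl
sumFrom-cong lo (suc k) f≗g = cong₂ _+_ (f≗g lo) (sumFrom-cong (suc lo) k f≗g)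

sumFrom-+ : ∀ lo k f g → sumFrom lo k (λ i → f i + g i) ≡ sumFrom lo k f + sumFrom lo k g
sumFrom-+ lo zero    f g = refl
sumFrom-+ lo (suc k) f g = begin
    f lo + g lo + sumFrom (suc lo) k (λ i → f i + g i)
  ≡⟨ cong (_+_ (f lo + g lo)) (sumFrom-+ (suc lo) k f g) ⟩
    f lo + g lo + (sumFrom (suc lo) k f + sumFrom (suc lo) k g)
  ≡⟨ interchange (f lo) (g lo) (sumFrom (suc lo) k f) (sumFrom (suc lo) k g) ⟩
    f lo + sumFrom (suc lo) k f + (g lo + sumFrom (suc lo) k g)
  ∎
  where
  interchange : ∀ x y u v → x + y + (u + v) ≡ x + u + (y + v)
  interchange = solve-∀

sumFrom-++ : ∀ lo m n f → sumFrom lo (m ℕ.+ n) f ≡ sumFrom lo m f + sumFrom (lo ℕ.+ m) n f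
sumFrom-++ lo zero    n f rewrite ℕ.+-identityʳ lo = sym (ℤ.+-identityˡ _)
sumFrom-++ lo (suc m) n f rewrite ℕ.+-suc lo m = begin
    f lo + sumFrom (suc lo) (m ℕ.+ n) f
  ≡⟨ cong (_+_ (f lo)) (sumFrom-++ (suc lo) m n f) ⟩
    f lo + (sumFrom (suc lo) m f + sumFrom (suc lo ℕ.+ m) n f)
  ≡⟨ sym (ℤ.+-assoc (f lo) _ _) ⟩
    f lo + sumFrom (suc lo) m f + sumFrom (suc lo ℕ.+ m) n f
  ∎

sumFrom-vanish : ∀ lo k f → (∀ i → i < lo ℕ.+ k → f i ≡ + 0) → sumFrom lo k f ≡ + 0
sumFrom-vanish lo zero    f f≡0 = refl
sumFrom-vanish lo (suc k) f f≡0 rewrite ℕ.+-suc lo k =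
  cong₂ _+_ (f≡0 lo (ℕ.m≤m+n (suc lo) k)) (sumFrom-vanish (suc lo) k f f≡0)

sumFrom-skip : ∀ m n f → m ≤ n → (∀ i → i < m → f i ≡ + 0) → sumFrom 0 n f ≡ sumFrom m (n ∸ m) f
sumFrom-skip m n f m≤n f≡0 = begin
    sumFrom 0 n f
  ≡⟨ cong (λ k → sumFrom 0 k f) (sym (ℕ.m+[n∸m]≡n m≤n)) ⟩
    sumFrom 0 (m ℕ.+ (n ∸ m)) f
  ≡⟨ sumFrom-++ 0 m (n ∸ m) f ⟩
    sumFrom 0 m f + sumFrom m (n ∸ m) f
  ≡⟨ cong (_+ sumFrom m (n ∸ m) f) (sumFrom-vanish 0 m f f≡0) ⟩
    + 0 + sumFrom m (n ∸ m) f
  ≡⟨ ℤ.+-identityˡ _ ⟩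
    sumFrom m (n ∸ m) f
  ∎

pascal : ∀ n k → suc n C suc k ≡ n C suc k ℕ.+ n C k
pascal n k = trans (sym (nCk+nC[k+1]≡[n+1]C[k+1] n k)) (ℕ.+-comm (n C k) (n C suc k))

binom-pascal-natTop : ∀ n k → binom (+ suc n) (k + + 1) ≡ binom (+ n) (k + + 1) + binom (+ n) k
binom-pascal-natTop n (+ k) rewrite ℕ.+-comm k 1 = cong +_ (pascal n k)
binom-pascal-natTop n -[1+ zero ]  = refl
binom-pascal-natTop n -[1+ suc k ] = refl

binom-pascal-natBottom : ∀ n k → binom (n + + 1) (+ suc k) ≡ binom n (+ suc k) + binom n (+ k)
binom-pascal-natBottom (+ n) k rewrite ℕ.+-comm n 1 = cong +_ (pascal n k)
binom-pascal-natBottom -[1+ zero ]  k = refl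
binom-pascal-natBottom -[1+ suc n ] k = refl

binom-negBottom : ∀ n {m k} → m < k → binom (+ n) (+ m - + k) ≡ + 0
binom-negBottom n {zero}  {suc k} _ = refl
binom-negBottom n {suc m} {suc k} (s≤s m<k) =
  trans (cong (binom (+ n)) (cancel-suc (+ m) (+ k))) (binom-negBottom n m<k)
  where
  cancel-suc : ∀ x y → (+ 1 + x) - (+ 1 + y) ≡ x - y
  cancel-suc = solve-∀

coeff : ℕ → ℕ → ℤ
coeff a ℓ = + 2 * binom (+ ℓ + + 1) (+ a - + ℓ) - binom (+ ℓ) (+ a - + ℓ)

diagonalBinom : ℕ → ℕ → ℤ
diagonalBinom j ℓ = binom (+ j - + ℓ - + 1) (+ ℓ)

term : ℕ → ℕ → ℕ → ℤ
term j a ℓ = coeff a ℓ * diagonalBinom j ℓ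

partialSum : ℕ → ℕ → ℕ → ℤ
partialSum M j a = sumFrom 0 M (term j a)

signedDeltaBinom : ℕ → ℕ → ℤ
signedDeltaBinom j a = binom (+ j) (+ a) - sgn j * δ j a

coeff-rec : ∀ a ℓ → coeff (suc (suc a)) (suc ℓ) ≡ coeff (suc a) ℓ + coeff a ℓ
coeff-rec a ℓ = begin
    + 2 * binom (+ suc (ℓ ℕ.+ 1)) (+ 2 + + a - (+ 1 + + ℓ)) - binom (+ suc ℓ) (+ 2 + + a - (+ 1 + + ℓ))
  ≡⟨ cong (λ t → + 2 * binom (+ suc (ℓ ℕ.+ 1)) t - binom (+ suc ℓ) t) (index₂ (+ a) (+ ℓ)) ⟩
    + 2 * binom (+ suc (ℓ ℕ.+ 1)) (d + + 1) - binom (+ suc ℓ) (d + + 1)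
  ≡⟨ cong₂ (λ u v → + 2 * u - v) (binom-pascal-natTop (ℓ ℕ.+ 1) d) (binom-pascal-natTop ℓ d) ⟩
    + 2 * (binom (+ (ℓ ℕ.+ 1)) (d + + 1) + binom (+ (ℓ ℕ.+ 1)) d) - (binom (+ ℓ) (d + + 1) + binom (+ ℓ) d)
  ≡⟨ regroup (binom (+ (ℓ ℕ.+ 1)) (d + + 1)) (binom (+ (ℓ ℕ.+ 1)) d) (binom (+ ℓ) (d + + 1)) (binom (+ ℓ) d) ⟩
    (+ 2 * binom (+ (ℓ ℕ.+ 1)) (d + + 1) - binom (+ ℓ) (d + + 1)) + coeff a ℓ
  ≡⟨ cong (λ t → (+ 2 * binom (+ (ℓ ℕ.+ 1)) t - binom (+ ℓ) t) + coeff a ℓ) (sym (index₁ (+ a) (+ ℓ))) ⟩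
    coeff (suc a) ℓ + coeff a ℓ
  ∎
  where
  d = + a - + ℓ
  index₂ : ∀ x y → (+ 2 + x) - (+ 1 + y) ≡ (x - y) + + 1
  index₂ = solve-∀
  index₁ : ∀ x y → (+ 1 + x) - y ≡ (x - y) + + 1
  index₁ = solve-∀
  regroup : ∀ u v w z → + 2 * (u + v) - (w + z) ≡ (+ 2 * u - w) + (+ 2 * v - z)
  regroup = solve-∀

diagonalBinom-rec : ∀ j ℓ →
  diagonalBinom (suc (suc j)) (suc ℓ) ≡ diagonalBinom (suc j) (suc ℓ) + diagonalBinom j ℓ
diagonalBinom-rec j ℓ = begin
    binom (+ 2 + + j - (+ 1 + + ℓ) - + 1) (+ suc ℓ)
  ≡⟨ cong (λ t → binom t (+ suc ℓ)) (top₂ (+ j) (+ ℓ)) ⟩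
    binom (n + + 1) (+ suc ℓ)
  ≡⟨ binom-pascal-natBottom n ℓ ⟩
    binom n (+ suc ℓ) + diagonalBinom j ℓ
  ≡⟨ cong (λ t → binom t (+ suc ℓ) + diagonalBinom j ℓ) (sym (top₁ (+ j) (+ ℓ))) ⟩
    diagonalBinom (suc j) (suc ℓ) + diagonalBinom j ℓ
  ∎
  where
  n = + j - + ℓ - + 1
  top₂ : ∀ x y → (+ 2 + x) - (+ 1 + y) - + 1 ≡ (x - y - + 1) + + 1
  top₂ = solve-∀
  top₁ : ∀ x y → (+ 1 + x) - (+ 1 + y) - + 1 ≡ x - y - + 1
  top₁ = solve-∀

term-rec : ∀ j a ℓ → term (suc (suc j)) (suc (suc a)) (suc ℓ)
  ≡ term (suc j) (suc (suc a)) (suc ℓ) + (term j (suc a) ℓ + term j a ℓ)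
term-rec j a ℓ = begin
    c * diagonalBinom (suc (suc j)) (suc ℓ)
  ≡⟨ cong (c *_) (diagonalBinom-rec j ℓ) ⟩
    c * (diagonalBinom (suc j) (suc ℓ) + diagonalBinom j ℓ)
  ≡⟨ ℤ.*-distribˡ-+ c _ _ ⟩
    c * diagonalBinom (suc j) (suc ℓ) + c * diagonalBinom j ℓ
  ≡⟨ cong (λ t → c * diagonalBinom (suc j) (suc ℓ) + t * diagonalBinom j ℓ) (coeff-rec a ℓ) ⟩
    c * diagonalBinom (suc j) (suc ℓ) + (coeff (suc a) ℓ + coeff a ℓ) * diagonalBinom j ℓ
  ≡⟨ cong (_+_ (c * diagonalBinom (suc j) (suc ℓ))) (ℤ.*-distribʳ-+ (diagonalBinom j ℓ) (coeff (suc a) ℓ) (coeff a ℓ)) ⟩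
    term (suc j) (suc (suc a)) (suc ℓ) + (term j (suc a) ℓ + term j a ℓ)
  ∎
  where c = coeff (suc (suc a)) (suc ℓ)

coeff-vanishes-above : ∀ a ℓ → a < ℓ → coeff a ℓ ≡ + 0
coeff-vanishes-above a ℓ a<ℓ =
  cong₂ (λ u v → + 2 * u - v) (binom-negBottom (ℓ ℕ.+ 1) a<ℓ) (binom-negBottom ℓ a<ℓ)

coeff-vanishes-below : ∀ a ℓ → suc ℓ ℕ.* 2 ≤ a → coeff a ℓ ≡ + 0
coeff-vanishes-below a ℓ 2ℓ+2≤a = begin
    coeff a ℓ
  ≡⟨ cong (λ t → + 2 * binom (+ ℓ + + 1) t - binom (+ ℓ) t) a-ℓ≡a∸ℓ ⟩
    + 2 * + ((ℓ ℕ.+ 1) C (a ∸ ℓ)) - + (ℓ C (a ∸ ℓ))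
  ≡⟨ cong₂ (λ u v → + 2 * + u - + v) (k>n⇒nCk≡0 ℓ+1<a∸ℓ) (k>n⇒nCk≡0 (ℕ.<⇒≤ 1+ℓ<a∸ℓ)) ⟩
    + 0
  ∎
  where
  double : ∀ n → suc n ℕ.* 2 ≡ suc (suc n) ℕ.+ n
  double = ℕ-Solver.solve-∀
  ℓ+2+ℓ≤a : suc (suc ℓ) ℕ.+ ℓ ≤ a
  ℓ+2+ℓ≤a = ℕ.≤-trans (ℕ.≤-reflexive (sym (double ℓ))) 2ℓ+2≤a
  a-ℓ≡a∸ℓ : + a - + ℓ ≡ + (a ∸ ℓ)
  a-ℓ≡a∸ℓ = trans (ℤ.m-n≡m⊖n a ℓ) (ℤ.⊖-≥ (ℕ.≤-trans (ℕ.m≤n+m ℓ _) ℓ+2+ℓ≤a))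
  1+ℓ<a∸ℓ : suc ℓ < a ∸ ℓ
  1+ℓ<a∸ℓ = ℕ.m+n≤o⇒m≤o∸n (suc (suc ℓ)) ℓ+2+ℓ≤a
  ℓ+1<a∸ℓ : ℓ ℕ.+ 1 < a ∸ ℓ
  ℓ+1<a∸ℓ rewrite ℕ.+-comm ℓ 1 = 1+ℓ<a∸ℓ

signedDeltaBinom-rec : ∀ j a → signedDeltaBinom (suc (suc j)) (suc (suc a))
  ≡ signedDeltaBinom (suc j) (suc (suc a)) + signedDeltaBinom j (suc a) + signedDeltaBinom j a
signedDeltaBinom-rec j a = begin
    + (suc (suc j) C suc (suc a)) - sgn (suc (suc j)) * δ j a
  ≡⟨ cong (λ n → + n - sgn (suc (suc j)) * δ j a) pascal² ⟩
    + (suc j C suc (suc a) ℕ.+ (j C suc a ℕ.+ j C a)) - - (- sgn j) * δ j a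
  ≡⟨ cancel (sgn j) (δ j a) (δ j (suc a)) (+ (suc j C suc (suc a))) (+ (j C suc a)) (+ (j C a)) ⟩
    signedDeltaBinom (suc j) (suc (suc a)) + signedDeltaBinom j (suc a) + signedDeltaBinom j a
  ∎
  where
  pascal² : suc (suc j) C suc (suc a) ≡ suc j C suc (suc a) ℕ.+ (j C suc a ℕ.+ j C a)
  pascal² = trans (pascal (suc j) (suc a)) (cong (suc j C suc (suc a) ℕ.+_) (pascal j a))
  cancel : ∀ s d₀ d₁ x y z →
    x + (y + z) - - (- s) * d₀ ≡ (x - (- s) * d₁) + (y - s * d₁) + (z - s * d₀)
  cancel = solve-∀

partialSum-peel : ∀ M j a → partialSum (suc M) j (suc (suc a)) ≡ sumFrom 0 M (term j (suc (suc a)) ∘ suc)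
-- The ℓ = 0 term c(a+2, 0) = 2 C(1, a+2) − C(0, a+2) vanishes by computation.
partialSum-peel M j a = trans (ℤ.+-identityˡ _) (sumFrom-shift 0 M (term j (suc (suc a))))

partialSum-rec : ∀ M j a → partialSum (suc M) (suc (suc j)) (suc (suc a))
  ≡ partialSum (suc M) (suc j) (suc (suc a)) + partialSum M j (suc a) + partialSum M j a
partialSum-rec M j a = begin
    partialSum (suc M) (suc (suc j)) (suc (suc a))
  ≡⟨ partialSum-peel M (suc (suc j)) a ⟩
    sumFrom 0 M (term (suc (suc j)) (suc (suc a)) ∘ suc)
  ≡⟨ sumFrom-cong 0 M (term-rec j a) ⟩
    sumFrom 0 M (λ ℓ → term (suc j) (suc (suc a)) (suc ℓ) + (term j (suc a) ℓ + term j a ℓ))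
  ≡⟨ sumFrom-+ 0 M _ _ ⟩
    sumFrom 0 M (term (suc j) (suc (suc a)) ∘ suc) + sumFrom 0 M (λ ℓ → term j (suc a) ℓ + term j a ℓ)
  ≡⟨ cong₂ _+_ (sym (partialSum-peel M (suc j) a)) (sumFrom-+ 0 M (term j (suc a)) (term j a)) ⟩
    partialSum (suc M) (suc j) (suc (suc a)) + (partialSum M j (suc a) + partialSum M j a)
  ≡⟨ sym (ℤ.+-assoc (partialSum (suc M) (suc j) (suc (suc a))) _ _) ⟩
    partialSum (suc M) (suc j) (suc (suc a)) + partialSum M j (suc a) + partialSum M j a
  ∎

partialSum-stable : ∀ j a → partialSum (suc (suc a)) j a ≡ partialSum (suc a) j a
partialSum-stable j a = begin
    sumFrom 0 (suc (suc a)) (term j a)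
  ≡⟨ cong (λ n → sumFrom 0 n (term j a)) (ℕ.+-comm 1 (suc a)) ⟩
    sumFrom 0 (suc a ℕ.+ 1) (term j a)
  ≡⟨ sumFrom-++ 0 (suc a) 1 (term j a) ⟩
    partialSum (suc a) j a + (coeff a (suc a) * diagonalBinom j (suc a) + + 0)
  ≡⟨ cong (λ c → partialSum (suc a) j a + (c * diagonalBinom j (suc a) + + 0))
          (coeff-vanishes-above a (suc a) ℕ.≤-refl) ⟩
    partialSum (suc a) j a + + 0
  ≡⟨ ℤ.+-identityʳ _ ⟩
    partialSum (suc a) j a
  ∎

diagonalBinom-zero : ∀ ℓ → diagonalBinom 0 ℓ ≡ + 0
diagonalBinom-zero zero    = refl
diagonalBinom-zero (suc ℓ) = refl

diagonalBinom-one : ∀ ℓ → diagonalBinom 1 (suc ℓ) ≡ + 0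
diagonalBinom-one zero    = refl
diagonalBinom-one (suc ℓ) = refl

diagonalBinom-suc-zero : ∀ j → diagonalBinom (suc j) 0 ≡ + 1
diagonalBinom-suc-zero j = cong (λ t → binom t (+ 0)) (top (+ j))
  where
  top : ∀ x → (+ 1 + x) - + 0 - + 1 ≡ x
  top = solve-∀

diagonalBinom-suc-one : ∀ j → diagonalBinom (suc (suc j)) 1 ≡ + j
diagonalBinom-suc-one j = trans (cong (λ t → binom t (+ 1)) (top (+ j))) (cong +_ (nC1≡n j))
  where
  top : ∀ x → (+ 2 + x) - + 1 - + 1 ≡ x
  top = solve-∀

partialSum-full : ∀ j a → partialSum (suc a) j a ≡ signedDeltaBinom j a
partialSum-full zero zero = refl
partialSum-full zero (suc a) =
  sumFrom-vanish 0 (suc (suc a)) (term 0 (suc a))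
    (λ ℓ _ → trans (cong (coeff (suc a) ℓ *_) (diagonalBinom-zero ℓ)) (ℤ.*-zeroʳ (coeff (suc a) ℓ)))
partialSum-full (suc j) zero =
  trans (cong (λ t → t + + 0) (diagonalBinom-suc-zero j)) (sym (cong (_-_ (+ 1)) (ℤ.*-zeroʳ (sgn (suc j)))))
partialSum-full (suc zero) (suc zero) = refl
partialSum-full (suc zero) (suc (suc a)) =
  sumFrom-vanish 0 (suc (suc (suc a))) (term 1 (suc (suc a))) vanish
  where
  vanish : ∀ ℓ → ℓ < suc (suc (suc a)) → term 1 (suc (suc a)) ℓ ≡ + 0
  vanish zero    _ = refl
  vanish (suc ℓ) _ = trans (cong (coeff (suc (suc a)) (suc ℓ) *_) (diagonalBinom-one ℓ))
                           (ℤ.*-zeroʳ (coeff (suc (suc a)) (suc ℓ)))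
partialSum-full (suc (suc j)) (suc zero) = begin
    + 2 * diagonalBinom (suc (suc j)) 0 + (+ 1 * diagonalBinom (suc (suc j)) 1 + + 0)
  ≡⟨ cong₂ (λ u v → + 2 * u + (+ 1 * v + + 0)) (diagonalBinom-suc-zero (suc j)) (diagonalBinom-suc-one j) ⟩
    + 2 * + 1 + (+ 1 * + j + + 0)
  ≡⟨ arith (+ j) (sgn (suc (suc j))) ⟩
    + (2 ℕ.+ j) - sgn (suc (suc j)) * + 0
  ≡⟨ cong (λ n → + n - sgn (suc (suc j)) * + 0) (sym (nC1≡n (suc (suc j)))) ⟩
    signedDeltaBinom (suc (suc j)) 1
  ∎
  where
  arith : ∀ x s → + 2 * + 1 + (+ 1 * x + + 0) ≡ + 2 + x - s * + 0
  arith = solve-∀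
partialSum-full (suc (suc j)) (suc (suc a)) = begin
    partialSum (suc (suc (suc a))) (suc (suc j)) (suc (suc a))
  ≡⟨ partialSum-rec (suc (suc a)) j a ⟩
    partialSum (suc (suc (suc a))) (suc j) (suc (suc a)) + partialSum (suc (suc a)) j (suc a)
      + partialSum (suc (suc a)) j a
  ≡⟨ cong₂ _+_ (cong₂ _+_ (partialSum-full (suc j) (suc (suc a))) (partialSum-full j (suc a)))
               (trans (partialSum-stable j a) (partialSum-full j a)) ⟩
    signedDeltaBinom (suc j) (suc (suc a)) + signedDeltaBinom j (suc a) + signedDeltaBinom j a
  ≡⟨ sym (signedDeltaBinom-rec j a) ⟩
    signedDeltaBinom (suc (suc j)) (suc (suc a))
  ∎

propositionB1 : (j a : ℕ) →
    binom (+ j) (+ a) - sgn j * δ j a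
      ≡ sumRange (a / 2) a (λ ℓ →
          ((+ 2) * binom (+ ℓ + + 1) (+ a - + ℓ) - binom (+ ℓ) (+ a - + ℓ))
            * binom (+ j - + ℓ - + 1) (+ ℓ))
propositionB1 j a = begin
    signedDeltaBinom j a
  ≡⟨ sym (partialSum-full j a) ⟩
    partialSum (suc a) j a
  ≡⟨ sumFrom-skip (a / 2) (suc a) (term j a) (ℕ.≤-trans (m/n≤m a 2) (ℕ.n≤1+n a)) vanish ⟩
    sumRange (a / 2) a (term j a)
  ∎
  where
  vanish : ∀ ℓ → ℓ < a / 2 → term j a ℓ ≡ + 0
  vanish ℓ ℓ<a/2 = cong (_* diagonalBinom j ℓ)
    (coeff-vanishes-below a ℓ (ℕ.≤-trans (ℕ.*-monoˡ-≤ 2 ℓ<a/2) (m/n*n≤m a 2)))
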